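{- Let $\mathcal{C}$ be a hyper-extensive category and $H\colon\mathcal{C}\to\mathcal{C}$ an endofunctor that preserves countable coproducts and has a terminal coalgebra $t\colon \nu H\to H(\nu H)$ (which is invertible). Let $Y$ be an object of $\mathcal{C}$, let $H^*Y=\coprod_{n<\omega}H^nY$ with coproduct injections $j_n\colon H^nY\to H^*Y$, and let $\phi_Y\colon HH^*Y\to H^*Y$ be the unique morphism with $\phi_Y\cdot Hj_n=j_{n+1}$ for all $n<\omega$ (using $HH^*Y\cong\coprod_{n<\omega}H^{n+1}Y$). Then the free cia (completely iterative algebra) for $H$ on $Y$ is \[CY=H^*Y+\nu H\] with algebra structure \[H(H^*Y+\nu H)\cong HH^*Y+H(\nu H)\xrightarrow{\ \phi_Y+t^{ -1}\ }H^*Y+\nu H\] and universal morphism $\mathrm{inl}\cdot j_0\colon Y\to H^*Y+\nu H$.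
   Context: A category is hyper-extensive if it has countable coproducts which are (1) universal (preserved by pullbacks along any morphism), (2) disjoint (coproduct injections are monic and distinct injections have pullback the initial object $0$), and (3) coherent (if $a_n\colon A_n\to A$, $n\in\mathbb{N}$, are pairwise disjoint morphisms each of which is a coproduct injection, then $[a_n]_n\colon\coprod_n A_n\to A$ is a coproduct injection). An $H$-algebra $a\colon HA\to A$ is a cia (completely iterative algebra) if for every morphism $e\colon X\to HX+A$ (a flat equation morphism) there is a unique morphism $e^\dagger\colon X\to A$ (a solution) with $e^\dagger=[a,\mathrm{id}_A]\cdot(He^\dagger+\mathrm{id}_A)\cdot e$. A free cia on $Y$ is a cia $(C,c)$ with a morphism $\eta\colon Y\to C$ such that for every cia $(B,b)$ and morphism $f\colon Y\to B$ there is a unique $H$-algebra morphism $g\colon(C,c)\to(B,b)$ with $g\cdot\eta=f$. $\mathrm{inl}$ denotes the left coproduct injection. -}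

module Defs where

open import Level using (Level; _⊔_; suc)
open import Data.Nat using (ℕ; zero; suc)
open import Data.Fin using (Fin)
open import Data.Bool using (Bool; true; false)
open import Data.Product using (Σ; _×_; _,_; proj₁)
open import Data.Sum using (_⊎_)
open import Function.Bundles using (_↔_)
open import Relation.Binary.PropositionalEquality using (_≡_)
open import Relation.Nullary using (¬_)

record Category (o ℓ e : Level) : Set (Level.suc (o ⊔ ℓ ⊔ e)) where
  infix  4 _≈_
  infixr 9 _∘_
  field
    Obj : Set o
    Hom : Obj → Obj → Set ℓ
    _≈_ : ∀ {A B} → Hom A B → Hom A B → Set e
    id  : ∀ {A} → Hom A A
    _∘_ : ∀ {A B C} → Hom B C → Hom A B → Hom A C
    ≈-refl  : ∀ {A B} {f : Hom A B} → f ≈ f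
    ≈-sym   : ∀ {A B} {f g : Hom A B} → f ≈ g → g ≈ f
    ≈-trans : ∀ {A B} {f g h : Hom A B} → f ≈ g → g ≈ h → f ≈ h
    ∘-resp-≈ : ∀ {A B C} {f h : Hom B C} {g i : Hom A B} →
               f ≈ h → g ≈ i → f ∘ g ≈ h ∘ i
    identityˡ : ∀ {A B} {f : Hom A B} → id ∘ f ≈ f
    identityʳ : ∀ {A B} {f : Hom A B} → f ∘ id ≈ f
    assoc : ∀ {A B C D} {f : Hom A B} {g : Hom B C} {h : Hom C D} →
            (h ∘ g) ∘ f ≈ h ∘ (g ∘ f)

record Functor {o ℓ e} (𝒞 : Category o ℓ e) : Set (o ⊔ ℓ ⊔ e) where
  open Category 𝒞
  field
    F₀ : Obj → Obj
    F₁ : ∀ {A B} → Hom A B → Hom (F₀ A) (F₀ B)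
    F-id : ∀ {A} → F₁ (id {A}) ≈ id
    F-∘  : ∀ {A B C} {f : Hom A B} {g : Hom B C} → F₁ (g ∘ f) ≈ F₁ g ∘ F₁ f
    F-resp-≈ : ∀ {A B} {f g : Hom A B} → f ≈ g → F₁ f ≈ F₁ g

module _ {o ℓ e} (𝒞 : Category o ℓ e) where
  open Category 𝒞

  ∃! : ∀ {A B} → (Hom A B → Set e) → Set (ℓ ⊔ e)
  ∃! {A} {B} P = Σ (Hom A B) λ f → P f × (∀ g → P g → g ≈ f)

  Monic : ∀ {A B} → Hom A B → Set (o ⊔ ℓ ⊔ e)
  Monic {A} f = ∀ {X} (g h : Hom X A) → f ∘ g ≈ f ∘ h → g ≈ h

  IsInitial : Obj → Set (o ⊔ ℓ ⊔ e)
  IsInitial O = ∀ X → ∃! {O} {X} (λ _ → ⊤ₑ)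
    where
      record ⊤ₑ : Set e where

  IsPullback : ∀ {A B C P} → Hom A C → Hom B C → Hom P A → Hom P B →
               Set (o ⊔ ℓ ⊔ e)
  IsPullback {A} {B} {C} {P} f g p q =
    (f ∘ p ≈ g ∘ q) ×
    (∀ {X} (h : Hom X A) (k : Hom X B) → f ∘ h ≈ g ∘ k →
       ∃! {X} {P} (λ u → (p ∘ u ≈ h) × (q ∘ u ≈ k)))

  record IsCoproduct {I : Set} (A : I → Obj) (S : Obj)
                     (ι : ∀ i → Hom (A i) S) : Set (o ⊔ ℓ ⊔ e) where
    field
      copair   : ∀ {X} → (∀ i → Hom (A i) X) → Hom S X
      copair-β : ∀ {X} (f : ∀ i → Hom (A i) X) i → copair f ∘ ι i ≈ f i
      copair-unique : ∀ {X} (f : ∀ i → Hom (A i) X) (h : Hom S X) →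
                      (∀ i → h ∘ ι i ≈ f i) → h ≈ copair f

  pair : Obj → Obj → Bool → Obj
  pair A B true  = A
  pair A B false = B

  IsBinCoproduct : ∀ {A B S} → Hom A S → Hom B S → Set (o ⊔ ℓ ⊔ e)
  IsBinCoproduct {A} {B} {S} inl inr = IsCoproduct (pair A B) S ι
    where
      ι : ∀ b → Hom (pair A B b) S
      ι true  = inl
      ι false = inr

  IsCoproductInjection : ∀ {A S} → Hom A S → Set (o ⊔ ℓ ⊔ e)
  IsCoproductInjection {A} {S} f =
    Σ Obj λ B → Σ (Hom B S) λ g → IsBinCoproduct f g

  Countable : Set → Set
  Countable I = (Σ ℕ λ n → I ↔ Fin n) ⊎ (I ↔ ℕ)

  Disjoint : ∀ {A B C} → Hom A C → Hom B C → Set (o ⊔ ℓ ⊔ e)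
  Disjoint {A} {B} f g =
    ∀ O (i : IsInitial O) →
      IsPullback f g (proj₁ (i A)) (proj₁ (i B))

  record HyperExtensive : Set (Level.suc Level.zero ⊔ o ⊔ ℓ ⊔ e) where
    field
      coproducts : ∀ (I : Set) → Countable I → (A : I → Obj) →
        Σ Obj λ S → Σ (∀ i → Hom (A i) S) λ ι → IsCoproduct A S ι
      pullbacks-exist : ∀ (I : Set) → Countable I → (A : I → Obj) →
        ∀ {S} (ι : ∀ i → Hom (A i) S) → IsCoproduct A S ι →
        ∀ {D} (f : Hom D S) (i : I) →
        Σ Obj λ P → Σ (Hom P D) λ p → Σ (Hom P (A i)) λ q → IsPullback f (ι i) p q
      universal : ∀ (I : Set) → Countable I → (A : I → Obj) →
        ∀ {S} (ι : ∀ i → Hom (A i) S) → IsCoproduct A S ι →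
        ∀ {D} (f : Hom D S) (P : I → Obj) (p : ∀ i → Hom (P i) D)
        (q : ∀ i → Hom (P i) (A i)) → (∀ i → IsPullback f (ι i) (p i) (q i)) →
        IsCoproduct P D p
      injections-monic : ∀ (I : Set) → Countable I → (A : I → Obj) →
        ∀ {S} (ι : ∀ i → Hom (A i) S) → IsCoproduct A S ι →
        ∀ i → Monic (ι i)
      disjoint : ∀ (I : Set) → Countable I → (A : I → Obj) →
        ∀ {S} (ι : ∀ i → Hom (A i) S) → IsCoproduct A S ι →
        ∀ i j → ¬ (i ≡ j) → Disjoint (ι i) (ι j)
      coherent : ∀ (A : ℕ → Obj) {X} (a : ∀ n → Hom (A n) X) →
        (∀ n m → ¬ (n ≡ m) → Disjoint (a n) (a m)) →
        (∀ n → IsCoproductInjection (a n)) →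
        ∀ {S} (ι : ∀ n → Hom (A n) S) (c : IsCoproduct A S ι) →
        IsCoproductInjection (IsCoproduct.copair c a)

module _ {o ℓ e} {𝒞 : Category o ℓ e} (H : Functor 𝒞) where
  open Category 𝒞
  open Functor H

  PreservesCountableCoproducts : Set (Level.suc Level.zero ⊔ o ⊔ ℓ ⊔ e)
  PreservesCountableCoproducts =
    ∀ (I : Set) → Countable 𝒞 I → (A : I → Obj) →
    ∀ {S} (ι : ∀ i → Hom (A i) S) → IsCoproduct 𝒞 A S ι →
    IsCoproduct 𝒞 (λ i → F₀ (A i)) (F₀ S) (λ i → F₁ (ι i))

  IsTerminalCoalgebra : ∀ {T} → Hom T (F₀ T) → Set (o ⊔ ℓ ⊔ e)
  IsTerminalCoalgebra {T} t =
    ∀ {X} (x : Hom X (F₀ X)) → ∃! 𝒞 {X} {T} (λ h → t ∘ h ≈ F₁ h ∘ x)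

  iter : ℕ → Obj → Obj
  iter zero    Y = Y
  iter (suc n) Y = F₀ (iter n Y)

  -- (A, a) is a completely iterative algebra: every flat equation morphism
  -- e : X → HX + A (for any binary coproduct HX + A) has a unique solution
  IsCia : ∀ {A} → Hom (F₀ A) A → Set (o ⊔ ℓ ⊔ e)
  IsCia {A} a =
    ∀ {X P} (inl : Hom (F₀ X) P) (inr : Hom A P) (c : IsBinCoproduct 𝒞 inl inr)
      (eq : Hom X P) →
    ∃! 𝒞 {X} {A} (λ s → s ≈ IsCoproduct.copair c (sol a s) ∘ eq)
    where
      sol : ∀ {X} → Hom (F₀ A) A → Hom X A → ∀ b → Hom (pair 𝒞 (F₀ X) A b) A
      sol a s true  = a ∘ F₁ s     -- [a, id] · (H s + id) on the left summand
      sol a s false = id           -- and on the right summand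

  IsAlgebraMorphism : ∀ {A B} → Hom (F₀ A) A → Hom (F₀ B) B → Hom A B → Set e
  IsAlgebraMorphism a b g = g ∘ a ≈ b ∘ F₁ g

  IsFreeCia : ∀ {Y C} → Hom (F₀ C) C → Hom Y C →
              Set (o ⊔ ℓ ⊔ e)
  IsFreeCia {Y} {C} c η =
    IsCia c ×
    (∀ {B} (b : Hom (F₀ B) B) → IsCia b → (f : Hom Y B) →
       ∃! 𝒞 {C} {B} (λ g → IsAlgebraMorphism c b g × (g ∘ η ≈ f)))

-- Hyper-extensivity lets us pull a flat equation morphism e : X → HX + CY back along its
-- own unfoldings: X splits into summands Qₙ, the variables whose n-th unfolding reaches
-- CY, and by coherence X = ∐ Qₙ + Z, where e restricts to a coalgebra Z → HZ. On each
-- Qₙ a solution is forced by recursion on n; on Z it must be inr after the unique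
-- coalgebra morphism into νH, because the part of Z that a solution sends into Hⁿ Y is
-- initial by induction on n. For freeness, an algebra morphism out of CY = ∐ Hⁿ Y + νH
-- is forced on Hⁿ Y by recursion and on νH by the cia property of its target.

module Submission where

open import Defs
open import Level using (Level; _⊔_)
open import Data.Nat using (ℕ; zero; suc; _<′_; ≤′-reflexive; ≤′-step)
open import Data.Nat.Properties using (_≟_; suc-injective; <-cmp; <⇒<′)
open import Data.Bool using (Bool; true; false)
open import Data.Empty using (⊥; ⊥-elim)
open import Data.Fin.Properties using (0↔⊥; 2↔Bool)
open import Data.Product using (Σ; _×_; _,_; proj₁; proj₂)
open import Data.Sum using (inj₁; inj₂)
open import Function.Properties.Inverse using (↔-refl; ↔-sym)
open import Relation.Binary.PropositionalEquality using (_≡_; refl)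
open import Relation.Binary.Definitions using (tri<; tri≈; tri>)
open import Relation.Nullary using (¬_; yes; no)

module CategoryFacts {o ℓ e} (𝒞 : Category o ℓ e) where
  open Category 𝒞 public
  open IsCoproduct public

  countable-Bool : Countable 𝒞 Bool
  countable-Bool = inj₁ (2 , ↔-sym 2↔Bool)

  countable-⊥ : Countable 𝒞 ⊥
  countable-⊥ = inj₁ (0 , ↔-sym 0↔⊥)

  countable-ℕ : Countable 𝒞 ℕ
  countable-ℕ = inj₂ ↔-refl

  infixr 2 _≈⟨_⟩_
  infix 3 _∎
  _≈⟨_⟩_ : ∀ {A B} (f : Hom A B) {g h : Hom A B} → f ≈ g → g ≈ h → f ≈ h
  f ≈⟨ p ⟩ q = ≈-trans p q
  _∎ : ∀ {A B} (f : Hom A B) → f ≈ f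
  f ∎ = ≈-refl

  infixr 4 refl⟩∘⟨_
  infixl 5 _⟩∘⟨refl
  refl⟩∘⟨_ : ∀ {A B C} {f : Hom B C} {g i : Hom A B} → g ≈ i → f ∘ g ≈ f ∘ i
  refl⟩∘⟨ q = ∘-resp-≈ ≈-refl q
  _⟩∘⟨refl : ∀ {A B C} {f h : Hom B C} {g : Hom A B} → f ≈ h → f ∘ g ≈ h ∘ g
  p ⟩∘⟨refl = ∘-resp-≈ p ≈-refl

  sym-assoc : ∀ {A B C D} {f : Hom A B} {g : Hom B C} {h : Hom C D} →
              h ∘ (g ∘ f) ≈ (h ∘ g) ∘ f
  sym-assoc = ≈-sym assoc

  pullˡ : ∀ {A B C D} {f : Hom C D} {g : Hom B C} {h : Hom A B} {k : Hom B D} →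
          f ∘ g ≈ k → f ∘ g ∘ h ≈ k ∘ h
  pullˡ p = ≈-trans sym-assoc (p ⟩∘⟨refl)

  pushˡ : ∀ {A B C D} {f : Hom C D} {g : Hom B C} {h : Hom A B} {k : Hom B D} →
          k ≈ f ∘ g → k ∘ h ≈ f ∘ g ∘ h
  pushˡ p = ≈-sym (pullˡ (≈-sym p))

  pullʳ : ∀ {A B C D} {f : Hom C D} {g : Hom B C} {h : Hom A B} {k : Hom A C} →
          g ∘ h ≈ k → (f ∘ g) ∘ h ≈ f ∘ k
  pullʳ p = ≈-trans assoc (refl⟩∘⟨ p)

  pushʳ : ∀ {A B C D} {f : Hom C D} {g : Hom B C} {h : Hom A B} {k : Hom A C} →
          k ≈ g ∘ h → f ∘ k ≈ (f ∘ g) ∘ h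
  pushʳ p = ≈-sym (pullʳ (≈-sym p))

  cancelʳ : ∀ {A B C} {f : Hom B C} {g : Hom A B} {h : Hom B A} →
            g ∘ h ≈ id → (f ∘ g) ∘ h ≈ f
  cancelʳ p = ≈-trans (pullʳ p) identityʳ

  IsInverse : ∀ {A B} → Hom A B → Hom B A → Set e
  IsInverse f g = (g ∘ f ≈ id) × (f ∘ g ≈ id)

  factor-along-section : ∀ {A D P S} {f : Hom D S} {p : Hom P D} {g : Hom A S} {q : Hom P A}
                         {v : Hom D P} → f ∘ p ≈ g ∘ q → p ∘ v ≈ id → f ≈ g ∘ q ∘ v
  factor-along-section {f = f} {p} {g} {q} {v} square section =
    f             ≈⟨ ≈-sym identityʳ ⟩
    f ∘ id        ≈⟨ refl⟩∘⟨ ≈-sym section ⟩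
    f ∘ p ∘ v     ≈⟨ pullˡ square ⟩
    (g ∘ q) ∘ v   ≈⟨ assoc ⟩
    g ∘ q ∘ v     ∎

  Initial : Obj → Set (o ⊔ ℓ ⊔ e)
  Initial W = ∀ X → Σ (Hom W X) λ f → ∀ g → g ≈ f

  initial-unique : ∀ {W X} → Initial W → (f g : Hom W X) → f ≈ g
  initial-unique i f g = ≈-trans (proj₂ (i _) f) (≈-sym (proj₂ (i _) g))

  Initial⇒IsInitial : ∀ {W} → Initial W → IsInitial 𝒞 W
  Initial⇒IsInitial i X = proj₁ (i X) , record {} , λ g _ → proj₂ (i X) g

  IsInitial⇒Initial : ∀ {W} → IsInitial 𝒞 W → Initial W
  IsInitial⇒Initial i X = proj₁ (i X) , λ g → proj₂ (proj₂ (i X)) g record {}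

  empty-coproduct-initial : ∀ {F : ⊥ → Obj} {S} {ι : ∀ i → Hom (F i) S} →
                            IsCoproduct 𝒞 F S ι → Initial S
  empty-coproduct-initial c X = copair c (λ ()) , λ g → copair-unique c (λ ()) g (λ ())

  initial-empty-coproduct : ∀ {W} → Initial W → IsCoproduct 𝒞 ⊥-elim W (λ ())
  initial-empty-coproduct i = record
    { copair = λ _ → proj₁ (i _)
    ; copair-β = λ _ ()
    ; copair-unique = λ _ h _ → proj₂ (i _) h
    }

  coproduct-ext : ∀ {I} {F : I → Obj} {S} {ι : ∀ i → Hom (F i) S} → IsCoproduct 𝒞 F S ι →
                  ∀ {X} {h k : Hom S X} → (∀ i → h ∘ ι i ≈ k ∘ ι i) → h ≈ k
  coproduct-ext c {h = h} {k} p =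
    ≈-trans (copair-unique c _ h p) (≈-sym (copair-unique c _ k (λ _ → ≈-refl)))

  coproduct-of-initials : ∀ {I} {F : I → Obj} {S} {ι : ∀ i → Hom (F i) S} →
                          IsCoproduct 𝒞 F S ι → (∀ i → Initial (F i)) → Initial S
  coproduct-of-initials c ii X =
    copair c (λ i → proj₁ (ii i X)) ,
    λ g → copair-unique c _ g (λ i → initial-unique (ii i) _ _)

  head-inverse : ∀ {F : ℕ → Obj} {S} {ι : ∀ n → Hom (F n) S} → IsCoproduct 𝒞 F S ι →
                 (∀ n → Initial (F (suc n))) → Σ (Hom S (F 0)) (IsInverse (ι 0))
  head-inverse {F} {ι = ι} c ii = copair c retract , copair-β c retract 0 , coproduct-ext c section
    where
    retract : ∀ n → Hom (F n) (F 0)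
    retract zero    = id
    retract (suc n) = proj₁ (ii n _)
    section : ∀ n → (ι 0 ∘ copair c retract) ∘ ι n ≈ id ∘ ι n
    section zero    = ≈-trans (cancelʳ (copair-β c retract 0)) (≈-sym identityˡ)
    section (suc n) = initial-unique (ii n) _ _

  cases : ∀ {A B X} → Hom A X → Hom B X → ∀ b → Hom (pair 𝒞 A B b) X
  cases f g true  = f
  cases f g false = g

  module Binary {A B S} {l : Hom A S} {r : Hom B S} (c : IsBinCoproduct 𝒞 l r) where
    [_,_] : ∀ {X} → Hom A X → Hom B X → Hom S X
    [ f , g ] = copair c (cases f g)

    inl-β : ∀ {X} {f : Hom A X} {g : Hom B X} → [ f , g ] ∘ l ≈ f
    inl-β {f = f} {g} = copair-β c (cases f g) true

    inr-β : ∀ {X} {f : Hom A X} {g : Hom B X} → [ f , g ] ∘ r ≈ g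
    inr-β {f = f} {g} = copair-β c (cases f g) false

    []-unique : ∀ {X} {f : Hom A X} {g : Hom B X} {h : Hom S X} →
                h ∘ l ≈ f → h ∘ r ≈ g → h ≈ [ f , g ]
    []-unique {f = f} {g} {h} p q = copair-unique c (cases f g) h λ { true → p ; false → q }

    binary-ext : ∀ {X} {h k : Hom S X} → h ∘ l ≈ k ∘ l → h ∘ r ≈ k ∘ r → h ≈ k
    binary-ext p q = ≈-trans ([]-unique p q) (≈-sym ([]-unique ≈-refl ≈-refl))

  Bool-coproduct⇒binary : ∀ {P : Bool → Obj} {S} {ι : ∀ b → Hom (P b) S} →
                          IsCoproduct 𝒞 P S ι → IsBinCoproduct 𝒞 (ι true) (ι false)
  Bool-coproduct⇒binary c = record
    { copair = λ f → copair c (λ { true → f true ; false → f false })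
    ; copair-β = λ f → λ { true → copair-β c _ true ; false → copair-β c _ false }
    ; copair-unique = λ f h eqs →
        copair-unique c _ h (λ { true → eqs true ; false → eqs false })
    }

  binary-swap : ∀ {A B S} {l : Hom A S} {r : Hom B S} →
                IsBinCoproduct 𝒞 l r → IsBinCoproduct 𝒞 r l
  binary-swap c = record
    { copair = λ f → [ f false , f true ]
    ; copair-β = λ f → λ { true → inr-β ; false → inl-β }
    ; copair-unique = λ f h eqs → []-unique (eqs false) (eqs true)
    }
    where open Binary c

  inl-inverse : ∀ {A B S} {l : Hom A S} {r : Hom B S} → IsBinCoproduct 𝒞 l r →
                Initial B → Σ (Hom S A) (IsInverse l)
  inl-inverse c i =
    [ id , proj₁ (i _) ] , inl-β ,
    binary-ext (≈-trans (cancelʳ inl-β) (≈-sym identityˡ)) (initial-unique i _ _)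
    where open Binary c

  _◂_ : Obj → (ℕ → Obj) → ℕ → Obj
  (B ◂ F) zero    = B
  (B ◂ F) (suc n) = F n

  flat-injections : ∀ {A B S} {F : ℕ → Obj} → Hom A S → Hom B S → (∀ n → Hom (F n) A) →
                    ∀ n → Hom ((B ◂ F) n) S
  flat-injections l r ι zero    = r
  flat-injections l r ι (suc n) = l ∘ ι n

  flatten : ∀ {A B S} {F : ℕ → Obj} {l : Hom A S} {r : Hom B S} {ι : ∀ n → Hom (F n) A} →
            IsBinCoproduct 𝒞 l r → IsCoproduct 𝒞 F A ι →
            IsCoproduct 𝒞 (B ◂ F) S (flat-injections l r ι)
  flatten c cA = record
    { copair = λ f → [ copair cA (λ n → f (suc n)) , f zero ]
    ; copair-β = λ f → λ { zero → inr-β ; (suc n) → ≈-trans (pullˡ inl-β) (copair-β cA _ n) }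
    ; copair-unique = λ f h eqs →
        []-unique (copair-unique cA _ _ (λ n → ≈-trans assoc (eqs (suc n)))) (eqs zero)
    }
    where open Binary c

module HyperExtensiveFacts {o ℓ e} (𝒞 : Category o ℓ e) (HE : HyperExtensive 𝒞) where
  open CategoryFacts 𝒞
  open HyperExtensive HE

  private
    empty-coproduct : Σ Obj λ S → Σ (∀ i → Hom (⊥-elim i) S) λ ι → IsCoproduct 𝒞 ⊥-elim S ι
    empty-coproduct = coproducts ⊥ countable-⊥ ⊥-elim

  𝟘 : Obj
  𝟘 = proj₁ empty-coproduct

  𝟘-initial : Initial 𝟘
  𝟘-initial = empty-coproduct-initial (proj₂ (proj₂ empty-coproduct))

  -- The pullback of the empty coproduct 𝟘 along u is again an empty coproduct.
  initial-strict : ∀ {W} → Hom W 𝟘 → Initial W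
  initial-strict u = empty-coproduct-initial
    (universal ⊥ countable-⊥ ⊥-elim _ (proj₂ (proj₂ empty-coproduct)) u ⊥-elim (λ ()) (λ ()) (λ ()))

  initial-from-map : ∀ {W B} → Hom W B → Initial B → Initial W
  initial-from-map f i = initial-strict (proj₁ (i 𝟘) ∘ f)

  DisjointCones : ∀ {A B C} → Hom A C → Hom B C → Set (o ⊔ ℓ ⊔ e)
  DisjointCones {A} {B} f g = ∀ {W} (h : Hom W A) (k : Hom W B) → f ∘ h ≈ g ∘ k → Initial W

  Disjoint⇒DisjointCones : ∀ {A B C} {f : Hom A C} {g : Hom B C} →
                           Disjoint 𝒞 f g → DisjointCones f g
  Disjoint⇒DisjointCones d h k eq =
    initial-strict (proj₁ (proj₂ (d 𝟘 (Initial⇒IsInitial 𝟘-initial)) h k eq))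

  DisjointCones⇒Disjoint : ∀ {A B C} {f : Hom A C} {g : Hom B C} →
                           DisjointCones f g → Disjoint 𝒞 f g
  DisjointCones⇒Disjoint d O i =
    initial-unique (IsInitial⇒Initial i) _ _ ,
    λ h k eq → let w = d h k eq in
      proj₁ (w O) , (initial-unique w _ _ , initial-unique w _ _) , λ u _ → proj₂ (w O) u

  DisjointCones-sym : ∀ {A B C} {f : Hom A C} {g : Hom B C} →
                      DisjointCones f g → DisjointCones g f
  DisjointCones-sym d h k eq = d k h (≈-sym eq)

  injections-disjoint : ∀ {A B S} {l : Hom A S} {r : Hom B S} →
                        IsBinCoproduct 𝒞 l r → DisjointCones l r
  injections-disjoint {A} {B} c =
    Disjoint⇒DisjointCones (disjoint Bool countable-Bool (pair 𝒞 A B) _ c true false (λ ()))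

  ℕ-injections-disjoint : ∀ {F : ℕ → Obj} {S} {ι : ∀ n → Hom (F n) S} →
                          IsCoproduct 𝒞 F S ι → ∀ {n k} → ¬ n ≡ k → DisjointCones (ι n) (ι k)
  ℕ-injections-disjoint c n≢k =
    Disjoint⇒DisjointCones (disjoint ℕ countable-ℕ _ _ c _ _ n≢k)

  inl-monic : ∀ {A B S} {l : Hom A S} {r : Hom B S} → IsBinCoproduct 𝒞 l r → Monic 𝒞 l
  inl-monic {A} {B} c = injections-monic Bool countable-Bool (pair 𝒞 A B) _ c true

  injection-monic : ∀ {A S} {f : Hom A S} → IsCoproductInjection 𝒞 f → Monic 𝒞 f
  injection-monic (_ , _ , c) = inl-monic c

  binary-coproduct : ∀ A B → Σ Obj λ S → Σ (Hom A S) λ l → Σ (Hom B S) λ r → IsBinCoproduct 𝒞 l r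
  binary-coproduct A B with coproducts Bool countable-Bool (pair 𝒞 A B)
  ... | S , ι , c = S , ι true , ι false , Bool-coproduct⇒binary c

  record PullbackFamily {I : Set} (F : I → Obj) {S} (ι : ∀ i → Hom (F i) S) {D} (f : Hom D S)
                        : Set (o ⊔ ℓ ⊔ e) where
    field
      P : I → Obj
      p : ∀ i → Hom (P i) D
      q : ∀ i → Hom (P i) (F i)
      pullback : ∀ i → IsPullback 𝒞 f (ι i) (p i) (q i)
      coproduct : IsCoproduct 𝒞 P D p

    commutes : ∀ i → f ∘ p i ≈ ι i ∘ q i
    commutes i = proj₁ (pullback i)

  pullback-family : ∀ (I : Set) → Countable 𝒞 I → (F : I → Obj) → ∀ {S} (ι : ∀ i → Hom (F i) S) →
                    IsCoproduct 𝒞 F S ι → ∀ {D} (f : Hom D S) → PullbackFamily F ι f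
  pullback-family I cnt F ι c {D} f = record
    { P = λ i → proj₁ (pb i)
    ; p = λ i → proj₁ (proj₂ (pb i))
    ; q = λ i → proj₁ (proj₂ (proj₂ (pb i)))
    ; pullback = λ i → proj₂ (proj₂ (proj₂ (pb i)))
    ; coproduct = universal I cnt F ι c f _ _ _ (λ i → proj₂ (proj₂ (proj₂ (pb i))))
    }
    where
    pb : ∀ i → Σ Obj λ Pᵢ → Σ (Hom Pᵢ D) λ p → Σ (Hom Pᵢ (F i)) λ q → IsPullback 𝒞 f (ι i) p q
    pb = pullbacks-exist I cnt F ι c f

  pullback-factor : ∀ {A B C P} {f : Hom A C} {g : Hom B C} {p : Hom P A} {q : Hom P B} →
                    IsPullback 𝒞 f g p q → ∀ {W} (h : Hom W A) (k : Hom W B) → f ∘ h ≈ g ∘ k →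
                    Σ (Hom W P) λ u → (p ∘ u ≈ h) × (q ∘ u ≈ k)
  pullback-factor pb h k eq = proj₁ (proj₂ pb h k eq) , proj₁ (proj₂ (proj₂ pb h k eq))

  pullback-cone-initial : ∀ {A B C P} {f : Hom A C} {g : Hom B C} {p : Hom P A} {q : Hom P B} →
                          IsPullback 𝒞 f g p q → Initial P → DisjointCones f g
  pullback-cone-initial pb i h k eq = initial-from-map (proj₁ (pullback-factor pb h k eq)) i

  factor-through-head : ∀ {F : ℕ → Obj} {S} {ι : ∀ n → Hom (F n) S} → IsCoproduct 𝒞 F S ι →
                        ∀ {D} (f : Hom D S) → (∀ n → DisjointCones f (ι (suc n))) →
                        Σ (Hom D (F 0)) λ g → f ≈ ι 0 ∘ g
  factor-through-head {F} {ι = ι} c {D} f d =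
    q 0 ∘ proj₁ inverse , factor-along-section (commutes 0) (proj₂ (proj₂ inverse))
    where
    open PullbackFamily (pullback-family ℕ countable-ℕ F ι c f)
    inverse : Σ (Hom D (P 0)) (IsInverse (p 0))
    inverse = head-inverse coproduct (λ n → d n (p (suc n)) (q (suc n)) (commutes (suc n)))

  factor-through-inl : ∀ {A B S} {l : Hom A S} {r : Hom B S} → IsBinCoproduct 𝒞 l r →
                       ∀ {D} (f : Hom D S) → DisjointCones f r → Σ (Hom D A) λ g → f ≈ l ∘ g
  factor-through-inl {A} {B} c {D} f d =
    q true ∘ proj₁ inverse , factor-along-section (commutes true) (proj₂ (proj₂ inverse))
    where
    open PullbackFamily (pullback-family Bool countable-Bool (pair 𝒞 A B) _ c f)
    inverse : Σ (Hom D (P true)) (IsInverse (p true))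
    inverse = inl-inverse (Bool-coproduct⇒binary coproduct) (d (p false) (q false) (commutes false))

  id-injection : ∀ {A} → IsCoproductInjection 𝒞 (id {A})
  id-injection = 𝟘 , proj₁ (𝟘-initial _) , record
    { copair = λ f → f true
    ; copair-β = λ f → λ { true → identityʳ ; false → initial-unique 𝟘-initial _ _ }
    ; copair-unique = λ f h eqs → ≈-trans (≈-sym identityʳ) (eqs true)
    }

  -- If S = B + B' and B = A + A', then S = A + (A' + B').
  ∘-injection : ∀ {A B S} {f : Hom A B} {g : Hom B S} → IsCoproductInjection 𝒞 f →
                IsCoproductInjection 𝒞 g → IsCoproductInjection 𝒞 (g ∘ f)
  ∘-injection {A} {B} {S} {f} {g} (A′ , f′ , cf) (B′ , g′ , cg) with binary-coproduct A′ B′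
  ... | K , k₁ , k₂ , ck = K , K.[ g ∘ f′ , g′ ] , record
    { copair = λ h → G.[ F.[ h true , h false ∘ k₁ ] , h false ∘ k₂ ]
    ; copair-β = λ h → λ
        { true → ≈-trans (pullˡ G.inl-β) F.inl-β
        ; false → K.binary-ext (≈-trans (pullʳ K.inl-β) (≈-trans (pullˡ G.inl-β) F.inr-β))
                               (≈-trans (pullʳ K.inr-β) G.inr-β)
        }
    ; copair-unique = λ h u eqs →
        G.[]-unique
          (F.[]-unique (≈-trans assoc (eqs true)) (≈-trans assoc (on-summand (eqs false) K.inl-β)))
          (on-summand (eqs false) K.inr-β)
    }
    where
    module F = Binary cf
    module G = Binary cg
    module K = Binary ck
    on-summand : ∀ {C X} {u : Hom S X} {w : Hom K X} {k : Hom C K} {m : Hom C S} →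
                 u ∘ K.[ g ∘ f′ , g′ ] ≈ w → K.[ g ∘ f′ , g′ ] ∘ k ≈ m → u ∘ m ≈ w ∘ k
    on-summand eq β = ≈-trans (refl⟩∘⟨ ≈-sym β) (≈-trans sym-assoc (eq ⟩∘⟨refl))

module PreservationFacts {o ℓ e} (𝒞 : Category o ℓ e) (H : Functor 𝒞)
                         (pres : PreservesCountableCoproducts H) where
  open CategoryFacts 𝒞
  open Functor H public

  sym-F-∘ : ∀ {A B C} {f : Hom B C} {g : Hom A B} → F₁ f ∘ F₁ g ≈ F₁ (f ∘ g)
  sym-F-∘ = ≈-sym F-∘

  F-binary : ∀ {A B S} {l : Hom A S} {r : Hom B S} → IsBinCoproduct 𝒞 l r →
             IsBinCoproduct 𝒞 (F₁ l) (F₁ r)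
  F-binary {A} {B} c = Bool-coproduct⇒binary (pres Bool countable-Bool (pair 𝒞 A B) _ c)

  F-initial : ∀ {W} → Initial W → Initial (F₀ W)
  F-initial i = empty-coproduct-initial (pres ⊥ countable-⊥ ⊥-elim (λ ()) (initial-empty-coproduct i))

  F-coproduct-ℕ : ∀ {F : ℕ → Obj} {S} {ι : ∀ n → Hom (F n) S} → IsCoproduct 𝒞 F S ι →
                  IsCoproduct 𝒞 (λ n → F₀ (F n)) (F₀ S) (λ n → F₁ (ι n))
  F-coproduct-ℕ = pres ℕ countable-ℕ _ _

module FlatEquation {o ℓ e} (𝒞 : Category o ℓ e) (HE : HyperExtensive 𝒞) (H : Functor 𝒞)
                    (pres : PreservesCountableCoproducts H)
                    {X C P : Category.Obj 𝒞} (inlP : Category.Hom 𝒞 (Functor.F₀ H X) P)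
                    (inrP : Category.Hom 𝒞 C P) (cP : IsBinCoproduct 𝒞 inlP inrP)
                    (ε : Category.Hom 𝒞 X P) where
  open CategoryFacts 𝒞
  open HyperExtensiveFacts 𝒞 HE
  open HyperExtensive HE
  open PreservationFacts 𝒞 H pres

  -- At stage n, Rest is the summand of X not yet resolved by n unfoldings of ε, and
  -- unfold : Rest → Target + H Rest is its n-th unfolding. Pulling back splits Rest into
  -- Done, the variables whose n-th unfolding reaches the parameters, and Next.
  record Stage : Set (o ⊔ ℓ ⊔ e) where
    field
      Rest : Obj
      rest : Hom Rest X
      rest-injection : IsCoproductInjection 𝒞 rest
      Codomain Target : Obj
      unfold : Hom Rest Codomain
      κ-target : Hom Target Codomain
      κ-rest : Hom (F₀ Rest) Codomain
      Done Next : Obj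
      done : Hom Done Rest
      done-target : Hom Done Target
      next : Hom Next Rest
      next-unfold : Hom Next (F₀ Rest)
      done-pullback : IsPullback 𝒞 unfold κ-target done done-target
      next-pullback : IsPullback 𝒞 unfold κ-rest next next-unfold
      Rest-split : IsBinCoproduct 𝒞 done next
      ε-on-next : ε ∘ rest ∘ next ≈ inlP ∘ F₁ rest ∘ next-unfold

    ε-on-next-square : ∀ {V W} {h : Hom W Next} {g : Hom V Rest} {k : Hom W (F₀ V)} →
                       next-unfold ∘ h ≈ F₁ g ∘ k → ε ∘ (rest ∘ next) ∘ h ≈ inlP ∘ F₁ (rest ∘ g) ∘ k
    ε-on-next-square {h = h} {g} {k} sq =
      ε ∘ (rest ∘ next) ∘ h              ≈⟨ sym-assoc ⟩
      (ε ∘ rest ∘ next) ∘ h              ≈⟨ ε-on-next ⟩∘⟨refl ⟩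
      (inlP ∘ F₁ rest ∘ next-unfold) ∘ h ≈⟨ pullʳ assoc ⟩
      inlP ∘ F₁ rest ∘ next-unfold ∘ h   ≈⟨ refl⟩∘⟨ refl⟩∘⟨ sq ⟩
      inlP ∘ F₁ rest ∘ F₁ g ∘ k          ≈⟨ refl⟩∘⟨ pullˡ sym-F-∘ ⟩
      inlP ∘ F₁ (rest ∘ g) ∘ k           ∎

  split-stage : (Rest : Obj) (rest : Hom Rest X) → IsCoproductInjection 𝒞 rest →
                (Codomain Target : Obj) (unfold : Hom Rest Codomain)
                (κ-target : Hom Target Codomain) (κ-rest : Hom (F₀ Rest) Codomain) →
                IsBinCoproduct 𝒞 κ-target κ-rest →
                (∀ {W} {h : Hom W Rest} {k : Hom W (F₀ Rest)} →
                   unfold ∘ h ≈ κ-rest ∘ k → ε ∘ rest ∘ h ≈ inlP ∘ F₁ rest ∘ k) →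
                Stage
  split-stage Rest rest rest-injection Codomain Target unfold κ-target κ-rest c ε-on-rest = record
    { Rest = Rest ; rest = rest ; rest-injection = rest-injection
    ; Codomain = Codomain ; Target = Target ; unfold = unfold
    ; κ-target = κ-target ; κ-rest = κ-rest
    ; Done = PB.P true ; done = PB.p true ; done-target = PB.q true
    ; Next = PB.P false ; next = PB.p false ; next-unfold = PB.q false
    ; done-pullback = PB.pullback true ; next-pullback = PB.pullback false
    ; Rest-split = Bool-coproduct⇒binary PB.coproduct
    ; ε-on-next = ε-on-rest (PB.commutes false)
    }
    where
    module PB = PullbackFamily (pullback-family Bool countable-Bool (pair 𝒞 Target (F₀ Rest)) _ c unfold)

  next-stage : Stage → Stage
  next-stage s =
    split-stage Next (rest ∘ next) (∘-injection (Done , done , binary-swap Rest-split) rest-injection)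
                (F₀ Rest) (F₀ Done) next-unfold (F₁ done) (F₁ next) (F-binary Rest-split)
                ε-on-next-square
    where open Stage s

  stage : ℕ → Stage
  stage zero = split-stage X id id-injection P C ε inrP inlP (binary-swap cP) ε-on-X
    where
    ε-on-X : ∀ {W} {h : Hom W X} {k : Hom W (F₀ X)} → ε ∘ h ≈ inlP ∘ k → ε ∘ id ∘ h ≈ inlP ∘ F₁ id ∘ k
    ε-on-X sq = ≈-trans (refl⟩∘⟨ identityˡ) (≈-trans sq (refl⟩∘⟨ ≈-sym (≈-trans (F-id ⟩∘⟨refl) identityˡ)))
  stage (suc n) = next-stage (stage n)

  module S n = Stage (stage n)

  Q : ℕ → Obj
  Q n = S.Done n

  incl : ∀ n → Hom (Q n) X
  incl n = S.rest n ∘ S.done n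

  ε-on-Q-zero : ε ∘ incl 0 ≈ inrP ∘ S.done-target 0
  ε-on-Q-zero = ≈-trans (refl⟩∘⟨ identityˡ) (proj₁ (S.done-pullback 0))

  ε-on-Q-suc : ∀ n → ε ∘ incl (suc n) ≈ inlP ∘ F₁ (incl n) ∘ S.done-target (suc n)
  ε-on-Q-suc n = S.ε-on-next-square n (proj₁ (S.done-pullback (suc n)))

  factor-through-next : ∀ n {W} (h : Hom W X) (k : Hom W (F₀ (S.Rest n))) →
                        ε ∘ h ≈ inlP ∘ F₁ (S.rest n) ∘ k →
                        Σ (Hom W (S.Next n)) λ u → ((S.rest n ∘ S.next n) ∘ u ≈ h) × (S.next-unfold n ∘ u ≈ k)
  factor-through-next zero h k eq
    with pullback-factor (S.next-pullback 0) h k (≈-trans eq (refl⟩∘⟨ ≈-trans (F-id ⟩∘⟨refl) identityˡ))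
  ... | u , u-next , u-unfold = u , ≈-trans (identityˡ ⟩∘⟨refl) u-next , u-unfold
  factor-through-next (suc n) h k eq
    with factor-through-next n h (F₁ (S.next n) ∘ k) (≈-trans eq (refl⟩∘⟨ pushˡ F-∘))
  ... | u′ , u′-next , u′-unfold with pullback-factor (S.next-pullback (suc n)) u′ k u′-unfold
  ... | u , u-next , u-unfold = u , ≈-trans (pullʳ u-next) u′-next , u-unfold

  later-rest-through-next : ∀ {n k} → n <′ k →
                            Σ (Hom (S.Rest k) (S.Next n)) λ σ → S.rest k ≈ (S.rest n ∘ S.next n) ∘ σ
  later-rest-through-next (≤′-reflexive refl) = id , ≈-sym identityʳ
  later-rest-through-next {n} (≤′-step {k} n<′k) with later-rest-through-next n<′k
  ... | σ , eq = σ ∘ S.next k , ≈-trans (eq ⟩∘⟨refl) assoc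

  incl-disjoint-< : ∀ {n k} → n <′ k → DisjointCones (incl n) (incl k)
  incl-disjoint-< {n} {k} n<′k h h′ eq with later-rest-through-next n<′k
  ... | σ , eqσ = injections-disjoint (S.Rest-split n) h (σ ∘ S.done k ∘ h′)
    (injection-monic (S.rest-injection n) _ _
      (≈-trans sym-assoc (≈-trans eq (≈-trans assoc (≈-trans (eqσ ⟩∘⟨refl) (≈-trans assoc assoc))))))

  incl-disjoint : ∀ {n k} → ¬ n ≡ k → DisjointCones (incl n) (incl k)
  incl-disjoint {n} {k} n≢k with <-cmp n k
  ... | tri< n<k _ _ = incl-disjoint-< (<⇒<′ n<k)
  ... | tri≈ _ n≡k _ = ⊥-elim (n≢k n≡k)
  ... | tri> _ _ k<n = DisjointCones-sym (incl-disjoint-< (<⇒<′ k<n))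

  incl-injection : ∀ n → IsCoproductInjection 𝒞 (incl n)
  incl-injection n = ∘-injection (S.Next n , S.next n , S.Rest-split n) (S.rest-injection n)

  ∐Q : Obj
  ∐Q = proj₁ (coproducts ℕ countable-ℕ Q)

  ιQ : ∀ n → Hom (Q n) ∐Q
  ιQ = proj₁ (proj₂ (coproducts ℕ countable-ℕ Q))

  ∐Q-coproduct : IsCoproduct 𝒞 Q ∐Q ιQ
  ∐Q-coproduct = proj₂ (proj₂ (coproducts ℕ countable-ℕ Q))

  [incl] : Hom ∐Q X
  [incl] = copair ∐Q-coproduct incl

  [incl]-β : ∀ n → [incl] ∘ ιQ n ≈ incl n
  [incl]-β = copair-β ∐Q-coproduct incl

  [incl]-injection : IsCoproductInjection 𝒞 [incl]
  [incl]-injection = coherent Q incl (λ n k n≢k → DisjointCones⇒Disjoint (incl-disjoint n≢k))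
                              incl-injection ιQ ∐Q-coproduct

  Z : Obj
  Z = proj₁ [incl]-injection

  z : Hom Z X
  z = proj₁ (proj₂ [incl]-injection)

  X-split : IsBinCoproduct 𝒞 [incl] z
  X-split = proj₂ (proj₂ [incl]-injection)

  X-decomposition : IsCoproduct 𝒞 (Z ◂ Q) X (flat-injections [incl] z ιQ)
  X-decomposition = flatten X-split ∐Q-coproduct

  Q-Z-disjoint : ∀ n → DisjointCones (incl n) z
  Q-Z-disjoint n u v eq = injections-disjoint X-split (ιQ n ∘ u) v (≈-trans (pullˡ ([incl]-β n)) eq)

  ε-on-Z-in-HX : Σ (Hom Z (F₀ X)) λ ez → ε ∘ z ≈ inlP ∘ ez
  ε-on-Z-in-HX = factor-through-inl cP (ε ∘ z) parameters-disjoint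
    where
    parameters-disjoint : DisjointCones (ε ∘ z) inrP
    parameters-disjoint h k eq with pullback-factor (S.done-pullback 0) (z ∘ h) k (≈-trans sym-assoc eq)
    ... | u , u-done , _ = Q-Z-disjoint 0 u h (≈-trans (pullʳ u-done) identityˡ)

  private
    ez′ : Hom Z (F₀ X)
    ez′ = proj₁ ε-on-Z-in-HX

  ε-on-Z-via-HQ : ∀ n {W} (v : Hom W Z) (w : Hom W (F₀ (Q n))) → ez′ ∘ v ≈ F₁ ([incl] ∘ ιQ n) ∘ w →
                  ε ∘ z ∘ v ≈ inlP ∘ F₁ (S.rest n) ∘ F₁ (S.done n) ∘ w
  ε-on-Z-via-HQ n v w eq =
    ε ∘ z ∘ v                                ≈⟨ pullˡ (proj₂ ε-on-Z-in-HX) ⟩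
    (inlP ∘ ez′) ∘ v                         ≈⟨ pullʳ eq ⟩
    inlP ∘ F₁ ([incl] ∘ ιQ n) ∘ w            ≈⟨ refl⟩∘⟨ F-resp-≈ ([incl]-β n) ⟩∘⟨refl ⟩
    inlP ∘ F₁ (incl n) ∘ w                   ≈⟨ refl⟩∘⟨ pushˡ F-∘ ⟩
    inlP ∘ F₁ (S.rest n) ∘ F₁ (S.done n) ∘ w ∎

  ez′-disjoint-from-HQ : ∀ n → DisjointCones ez′ (F₁ ([incl] ∘ ιQ n))
  ez′-disjoint-from-HQ n {W} v w eq =
    Q-Z-disjoint (suc n) (proj₁ through-done) v
      (≈-trans (pullʳ (proj₁ (proj₂ through-done))) (proj₁ (proj₂ through-next)))
    where
    through-next : Σ (Hom W (S.Next n)) λ u →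
                     ((S.rest n ∘ S.next n) ∘ u ≈ z ∘ v) × (S.next-unfold n ∘ u ≈ F₁ (S.done n) ∘ w)
    through-next = factor-through-next n (z ∘ v) (F₁ (S.done n) ∘ w) (ε-on-Z-via-HQ n v w eq)
    through-done : Σ (Hom W (Q (suc n))) λ u →
                     (S.done (suc n) ∘ u ≈ proj₁ through-next) × (S.done-target (suc n) ∘ u ≈ w)
    through-done = pullback-factor (S.done-pullback (suc n)) (proj₁ through-next) w
                     (proj₂ (proj₂ through-next))

  -- Z is disjoint from every Qₙ, so ε maps it into HX avoiding every HQₙ, i.e. into HZ.
  Z-coalgebra : Σ (Hom Z (F₀ Z)) λ ez → ε ∘ z ≈ inlP ∘ F₁ z ∘ ez
  Z-coalgebra = proj₁ through-Hz , ≈-trans (proj₂ ε-on-Z-in-HX) (refl⟩∘⟨ proj₂ through-Hz)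
    where
    through-Hz : Σ (Hom Z (F₀ Z)) λ ez → ez′ ≈ F₁ z ∘ ez
    through-Hz = factor-through-head (F-coproduct-ℕ X-decomposition) ez′ ez′-disjoint-from-HQ

module CiaFacts {o ℓ e} (𝒞 : Category o ℓ e) (HE : HyperExtensive 𝒞) (H : Functor 𝒞) where
  open CategoryFacts 𝒞
  open HyperExtensiveFacts 𝒞 HE
  open Functor H

  -- These g are exactly the solutions of the flat equation inl ∘ ez : Z → HZ + B.
  cia-corecursive : ∀ {B} (b : Hom (F₀ B) B) → IsCia H b → ∀ {Z} (ez : Hom Z (F₀ Z)) →
                    ∃! 𝒞 (λ g → g ≈ b ∘ F₁ g ∘ ez)
  cia-corecursive {B} b b-cia {Z} ez with binary-coproduct (F₀ Z) B
  ... | _ , inl , inr , c with b-cia inl inr c (inl ∘ ez)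
  ... | g , g-fixed , g-unique =
    g , ≈-trans g-fixed (≈-trans (pullˡ (copair-β c _ true)) assoc) ,
    λ g′ g′-fixed → g-unique g′ (≈-trans g′-fixed (≈-sym (≈-trans (pullˡ (copair-β c _ true)) assoc)))

module FreeCia {o ℓ e} (𝒞 : Category o ℓ e) (HE : HyperExtensive 𝒞) (H : Functor 𝒞)
               (pres : PreservesCountableCoproducts H)
               {νH : Category.Obj 𝒞} (t : Category.Hom 𝒞 νH (Functor.F₀ H νH))
               (terminal : IsTerminalCoalgebra H t)
               (t⁻¹ : Category.Hom 𝒞 (Functor.F₀ H νH) νH)
               (t⁻¹∘t : Category._≈_ 𝒞 (Category._∘_ 𝒞 t⁻¹ t) (Category.id 𝒞))
               (t∘t⁻¹ : Category._≈_ 𝒞 (Category._∘_ 𝒞 t t⁻¹) (Category.id 𝒞))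
               (Y : Category.Obj 𝒞) {H*Y : Category.Obj 𝒞}
               (j : ∀ n → Category.Hom 𝒞 (iter H n Y) H*Y)
               (H*Y-coproduct : IsCoproduct 𝒞 (λ n → iter H n Y) H*Y j)
               (φ : Category.Hom 𝒞 (Functor.F₀ H H*Y) H*Y)
               (φ-j : ∀ n → Category._≈_ 𝒞 (Category._∘_ 𝒞 φ (Functor.F₁ H (j n))) (j (suc n)))
               {CY : Category.Obj 𝒞} (inl : Category.Hom 𝒞 H*Y CY) (inr : Category.Hom 𝒞 νH CY)
               (CY-coproduct : IsBinCoproduct 𝒞 inl inr)
               (a : Category.Hom 𝒞 (Functor.F₀ H CY) CY)
               (a-inl : Category._≈_ 𝒞 (Category._∘_ 𝒞 a (Functor.F₁ H inl)) (Category._∘_ 𝒞 inl φ))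
               (a-inr : Category._≈_ 𝒞 (Category._∘_ 𝒞 a (Functor.F₁ H inr)) (Category._∘_ 𝒞 inr t⁻¹))
               where
  open CategoryFacts 𝒞
  open HyperExtensiveFacts 𝒞 HE
  open PreservationFacts 𝒞 H pres
  open CiaFacts 𝒞 HE H

  Hⁿ : ℕ → Obj
  Hⁿ n = iter H n Y

  ιC : ∀ n → Hom ((νH ◂ Hⁿ) n) CY
  ιC = flat-injections inl inr j

  CY-decomposition : IsCoproduct 𝒞 (νH ◂ Hⁿ) CY ιC
  CY-decomposition = flatten CY-coproduct H*Y-coproduct

  a-on-Hⁿ : ∀ n → a ∘ F₁ (inl ∘ j n) ≈ inl ∘ j (suc n)
  a-on-Hⁿ n = ≈-trans (refl⟩∘⟨ F-∘) (≈-trans (pullˡ a-inl) (≈-trans assoc (refl⟩∘⟨ φ-j n)))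

  a-on-νH : ∀ {W Z} {k : Hom Z νH} {h : Hom W (F₀ Z)} → a ∘ F₁ (inr ∘ k) ∘ h ≈ inr ∘ t⁻¹ ∘ F₁ k ∘ h
  a-on-νH = ≈-trans (refl⟩∘⟨ pushˡ F-∘) (≈-trans (pullˡ a-inr) assoc)

  inr-monic : Monic 𝒞 inr
  inr-monic = inl-monic (binary-swap CY-coproduct)

  unfold : ∀ {Z} → Hom Z (F₀ Z) → Hom Z νH
  unfold ez = proj₁ (terminal ez)

  unfold-fixed : ∀ {Z} (ez : Hom Z (F₀ Z)) → unfold ez ≈ t⁻¹ ∘ F₁ (unfold ez) ∘ ez
  unfold-fixed ez =
    unfold ez                       ≈⟨ ≈-sym identityˡ ⟩
    id ∘ unfold ez                  ≈⟨ ≈-sym t⁻¹∘t ⟩∘⟨refl ⟩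
    (t⁻¹ ∘ t) ∘ unfold ez           ≈⟨ pullʳ (proj₁ (proj₂ (terminal ez))) ⟩
    t⁻¹ ∘ F₁ (unfold ez) ∘ ez       ∎

  -- By induction on n, the part of Z that u sends to Hⁿ Y is initial: a sends H(Hⁿ Y)
  -- into Hⁿ⁺¹ Y and HνH into νH, and H preserves initial objects.
  module SolutionOnCoalgebra {Z} (ez : Hom Z (F₀ Z)) (u : Hom Z CY) (u-fixed : u ≈ a ∘ F₁ u ∘ ez) where
    module PZ = PullbackFamily (pullback-family ℕ countable-ℕ _ _ CY-decomposition u)

    piece-initial-step : ∀ n → (∀ k → n ≡ suc k → Initial (PZ.P (suc k))) → Initial (PZ.P (suc n))
    piece-initial-step n earlier = coproduct-of-initials PV.coproduct sub-piece-initial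
      where
      module PV = PullbackFamily
        (pullback-family ℕ countable-ℕ _ _ (F-coproduct-ℕ PZ.coproduct) (ez ∘ PZ.p (suc n)))

      sub-piece : ∀ i → ιC (suc n) ∘ PZ.q (suc n) ∘ PV.p i ≈ a ∘ F₁ (ιC i ∘ PZ.q i) ∘ PV.q i
      sub-piece i =
        ιC (suc n) ∘ PZ.q (suc n) ∘ PV.p i        ≈⟨ pullˡ (≈-sym (PZ.commutes (suc n))) ⟩
        (u ∘ PZ.p (suc n)) ∘ PV.p i               ≈⟨ (u-fixed ⟩∘⟨refl) ⟩∘⟨refl ⟩
        ((a ∘ F₁ u ∘ ez) ∘ PZ.p (suc n)) ∘ PV.p i ≈⟨ ≈-trans assoc assoc ⟩
        a ∘ (F₁ u ∘ ez) ∘ PZ.p (suc n) ∘ PV.p i   ≈⟨ refl⟩∘⟨ pullʳ (≈-trans sym-assoc (PV.commutes i)) ⟩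
        a ∘ F₁ u ∘ F₁ (PZ.p i) ∘ PV.q i           ≈⟨ refl⟩∘⟨ pullˡ sym-F-∘ ⟩
        a ∘ F₁ (u ∘ PZ.p i) ∘ PV.q i              ≈⟨ refl⟩∘⟨ F-resp-≈ (PZ.commutes i) ⟩∘⟨refl ⟩
        a ∘ F₁ (ιC i ∘ PZ.q i) ∘ PV.q i           ∎

      sub-piece-initial : ∀ i → Initial (PV.P i)
      sub-piece-initial zero =
        ℕ-injections-disjoint CY-decomposition {k = 0} (λ ()) _ _ (≈-trans (sub-piece zero) a-on-νH)
      sub-piece-initial (suc k) with n ≟ suc k
      ... | yes n≡1+k = initial-from-map (PV.q (suc k)) (F-initial (earlier k n≡1+k))
      ... | no n≢1+k =
        ℕ-injections-disjoint CY-decomposition {k = suc (suc k)} (λ eq → n≢1+k (suc-injective eq)) _ _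
          (≈-trans (sub-piece (suc k)) (≈-trans (refl⟩∘⟨ pushˡ F-∘) (pullˡ (a-on-Hⁿ k))))

    piece-initial : ∀ n → Initial (PZ.P (suc n))
    piece-initial zero    = piece-initial-step zero λ _ ()
    piece-initial (suc n) = piece-initial-step (suc n) λ { _ refl → piece-initial n }

    through-νH : Σ (Hom Z νH) λ w → u ≈ inr ∘ w
    through-νH = factor-through-head CY-decomposition u
                   (λ n → pullback-cone-initial (PZ.pullback (suc n)) (piece-initial n))

    w : Hom Z νH
    w = proj₁ through-νH

    w-coalgebra-morphism : t ∘ w ≈ F₁ w ∘ ez
    w-coalgebra-morphism =
      t ∘ w                   ≈⟨ refl⟩∘⟨ w-fixed ⟩
      t ∘ t⁻¹ ∘ F₁ w ∘ ez     ≈⟨ pullˡ t∘t⁻¹ ⟩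
      id ∘ F₁ w ∘ ez          ≈⟨ identityˡ ⟩
      F₁ w ∘ ez               ∎
      where
      w-fixed : w ≈ t⁻¹ ∘ F₁ w ∘ ez
      w-fixed = inr-monic _ _ (
        inr ∘ w               ≈⟨ ≈-sym (proj₂ through-νH) ⟩
        u                     ≈⟨ u-fixed ⟩
        a ∘ F₁ u ∘ ez         ≈⟨ refl⟩∘⟨ F-resp-≈ (proj₂ through-νH) ⟩∘⟨refl ⟩
        a ∘ F₁ (inr ∘ w) ∘ ez ≈⟨ a-on-νH ⟩
        inr ∘ t⁻¹ ∘ F₁ w ∘ ez ∎)

    through-unfold : u ≈ inr ∘ unfold ez
    through-unfold = ≈-trans (proj₂ through-νH) (refl⟩∘⟨ proj₂ (proj₂ (terminal ez)) w w-coalgebra-morphism)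

  module Solution {X P} (inlP : Hom (F₀ X) P) (inrP : Hom CY P) (cP : IsBinCoproduct 𝒞 inlP inrP)
                  (ε : Hom X P) where
    open FlatEquation 𝒞 HE H pres inlP inrP cP ε
    open Binary cP

    step : Hom X CY → Hom X CY
    step s = [ a ∘ F₁ s , id ] ∘ ε

    ez : Hom Z (F₀ Z)
    ez = proj₁ Z-coalgebra

    step-on-Z : ∀ s → step s ∘ z ≈ a ∘ F₁ (s ∘ z) ∘ ez
    step-on-Z s =
      step s ∘ z                           ≈⟨ pullʳ (proj₂ Z-coalgebra) ⟩
      [ a ∘ F₁ s , id ] ∘ inlP ∘ F₁ z ∘ ez ≈⟨ pullˡ inl-β ⟩
      (a ∘ F₁ s) ∘ F₁ z ∘ ez               ≈⟨ pullʳ (pullˡ sym-F-∘) ⟩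
      a ∘ F₁ (s ∘ z) ∘ ez                  ∎

    step-on-Q-zero : ∀ s → step s ∘ incl 0 ≈ S.done-target 0
    step-on-Q-zero s = ≈-trans (pullʳ ε-on-Q-zero) (≈-trans (pullˡ inr-β) identityˡ)

    step-on-Q-suc : ∀ s n → step s ∘ incl (suc n) ≈ a ∘ F₁ (s ∘ incl n) ∘ S.done-target (suc n)
    step-on-Q-suc s n =
      step s ∘ incl (suc n)                                          ≈⟨ pullʳ (ε-on-Q-suc n) ⟩
      [ a ∘ F₁ s , id ] ∘ inlP ∘ F₁ (incl n) ∘ S.done-target (suc n) ≈⟨ pullˡ inl-β ⟩
      (a ∘ F₁ s) ∘ F₁ (incl n) ∘ S.done-target (suc n)               ≈⟨ pullʳ (pullˡ sym-F-∘) ⟩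
      a ∘ F₁ (s ∘ incl n) ∘ S.done-target (suc n)                    ∎

    solution-on-Q : ∀ n → Hom (Q n) CY
    solution-on-Q zero    = S.done-target 0
    solution-on-Q (suc n) = a ∘ F₁ (solution-on-Q n) ∘ S.done-target (suc n)

    solution-on-Q-unique : ∀ s → s ≈ step s → ∀ n → s ∘ incl n ≈ solution-on-Q n
    solution-on-Q-unique s s-fixed zero = ≈-trans (s-fixed ⟩∘⟨refl) (step-on-Q-zero s)
    solution-on-Q-unique s s-fixed (suc n) =
      ≈-trans (s-fixed ⟩∘⟨refl) (≈-trans (step-on-Q-suc s n)
        (refl⟩∘⟨ F-resp-≈ (solution-on-Q-unique s s-fixed n) ⟩∘⟨refl))

    components : ∀ n → Hom ((Z ◂ Q) n) CY
    components zero    = inr ∘ unfold ez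
    components (suc n) = solution-on-Q n

    solution : Hom X CY
    solution = copair X-decomposition components

    solution-on-incl : ∀ n → solution ∘ incl n ≈ solution-on-Q n
    solution-on-incl n = ≈-trans (refl⟩∘⟨ ≈-sym ([incl]-β n)) (copair-β X-decomposition components (suc n))

    solution-fixed : solution ≈ step solution
    solution-fixed = coproduct-ext X-decomposition on-component
      where
      on-component : ∀ n → solution ∘ flat-injections [incl] z ιQ n ≈ step solution ∘ flat-injections [incl] z ιQ n
      on-component zero =
        solution ∘ z                            ≈⟨ copair-β X-decomposition components zero ⟩
        inr ∘ unfold ez                         ≈⟨ refl⟩∘⟨ unfold-fixed ez ⟩
        inr ∘ t⁻¹ ∘ F₁ (unfold ez) ∘ ez         ≈⟨ ≈-sym a-on-νH ⟩
        a ∘ F₁ (inr ∘ unfold ez) ∘ ez           ≈⟨ refl⟩∘⟨ F-resp-≈ (≈-sym (copair-β X-decomposition components zero)) ⟩∘⟨refl ⟩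
        a ∘ F₁ (solution ∘ z) ∘ ez              ≈⟨ ≈-sym (step-on-Z solution) ⟩
        step solution ∘ z                       ∎
      on-component (suc zero) =
        ≈-trans (copair-β X-decomposition components 1)
          (≈-sym (≈-trans (refl⟩∘⟨ [incl]-β 0) (step-on-Q-zero solution)))
      on-component (suc (suc n)) =
        ≈-trans (copair-β X-decomposition components (suc (suc n)))
          (≈-sym (≈-trans (refl⟩∘⟨ [incl]-β (suc n)) (≈-trans (step-on-Q-suc solution n)
            (refl⟩∘⟨ F-resp-≈ (solution-on-incl n) ⟩∘⟨refl))))

    solution-unique : ∀ s → s ≈ step s → s ≈ solution
    solution-unique s s-fixed = coproduct-ext X-decomposition on-component
      where
      on-component : ∀ n → s ∘ flat-injections [incl] z ιQ n ≈ solution ∘ flat-injections [incl] z ιQ n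
      on-component zero =
        ≈-trans (SolutionOnCoalgebra.through-unfold ez (s ∘ z)
                  (≈-trans (s-fixed ⟩∘⟨refl) (step-on-Z s)))
                (≈-sym (copair-β X-decomposition components zero))
      on-component (suc n) =
        ≈-trans (refl⟩∘⟨ [incl]-β n)
          (≈-trans (solution-on-Q-unique s s-fixed n) (≈-sym (copair-β X-decomposition components (suc n))))

  is-cia : IsCia H a
  is-cia {X} inlP inrP cP ε =
    solution , ≈-trans solution-fixed (step-is-copair solution _ ≈-refl ≈-refl ⟩∘⟨refl) ,
    λ s s-fixed → solution-unique s (≈-trans s-fixed (≈-sym (step-is-copair s _ ≈-refl ≈-refl) ⟩∘⟨refl))
    where
    open Solution inlP inrP cP ε
    open Binary cP
    -- IsCia phrases [ a ∘ F₁ s , id ] as the copair of a family local to its definition.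
    step-is-copair : ∀ s (f : ∀ b → Hom (pair 𝒞 (F₀ X) CY b) CY) → f true ≈ a ∘ F₁ s → f false ≈ id →
                     [ a ∘ F₁ s , id ] ≈ copair cP f
    step-is-copair s f p q =
      copair-unique cP f _ λ { true → ≈-trans inl-β (≈-sym p) ; false → ≈-trans inr-β (≈-sym q) }

  module Extension {B} (b : Hom (F₀ B) B) (b-cia : IsCia H b) (f : Hom Y B) where
    on-νH : Hom νH B
    on-νH = proj₁ (cia-corecursive b b-cia t)

    on-νH-fixed : on-νH ≈ b ∘ F₁ on-νH ∘ t
    on-νH-fixed = proj₁ (proj₂ (cia-corecursive b b-cia t))

    on-νH-unique : ∀ g → g ≈ b ∘ F₁ g ∘ t → g ≈ on-νH
    on-νH-unique = proj₂ (proj₂ (cia-corecursive b b-cia t))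

    on-Hⁿ : ∀ n → Hom (Hⁿ n) B
    on-Hⁿ zero    = f
    on-Hⁿ (suc n) = b ∘ F₁ (on-Hⁿ n)

    components : ∀ n → Hom ((νH ◂ Hⁿ) n) B
    components zero    = on-νH
    components (suc n) = on-Hⁿ n

    extension : Hom CY B
    extension = copair CY-decomposition components

    extension-β : ∀ n → extension ∘ ιC n ≈ components n
    extension-β = copair-β CY-decomposition components

    extension-morphism : IsAlgebraMorphism H a b extension
    extension-morphism = coproduct-ext (F-coproduct-ℕ CY-decomposition) on-component
      where
      on-component : ∀ n → (extension ∘ a) ∘ F₁ (ιC n) ≈ (b ∘ F₁ extension) ∘ F₁ (ιC n)
      on-component zero =
        (extension ∘ a) ∘ F₁ inr      ≈⟨ pullʳ a-inr ⟩
        extension ∘ inr ∘ t⁻¹         ≈⟨ pullˡ (extension-β zero) ⟩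
        on-νH ∘ t⁻¹                   ≈⟨ on-νH-fixed ⟩∘⟨refl ⟩
        (b ∘ F₁ on-νH ∘ t) ∘ t⁻¹      ≈⟨ pullʳ (cancelʳ t∘t⁻¹) ⟩
        b ∘ F₁ on-νH                  ≈⟨ refl⟩∘⟨ F-resp-≈ (≈-sym (extension-β zero)) ⟩
        b ∘ F₁ (extension ∘ inr)      ≈⟨ pushʳ F-∘ ⟩
        (b ∘ F₁ extension) ∘ F₁ inr   ∎
      on-component (suc n) =
        (extension ∘ a) ∘ F₁ (inl ∘ j n)   ≈⟨ pullʳ (a-on-Hⁿ n) ⟩
        extension ∘ inl ∘ j (suc n)         ≈⟨ extension-β (suc (suc n)) ⟩
        b ∘ F₁ (on-Hⁿ n)                    ≈⟨ refl⟩∘⟨ F-resp-≈ (≈-sym (extension-β (suc n))) ⟩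
        b ∘ F₁ (extension ∘ inl ∘ j n)      ≈⟨ pushʳ F-∘ ⟩
        (b ∘ F₁ extension) ∘ F₁ (inl ∘ j n) ∎

    extension-unique : ∀ g → IsAlgebraMorphism H a b g × (g ∘ inl ∘ j zero ≈ f) → g ≈ extension
    extension-unique g (g-morphism , g-η) = coproduct-ext CY-decomposition on-component
      where
      on-Hⁿ-unique : ∀ n → g ∘ inl ∘ j n ≈ on-Hⁿ n
      on-Hⁿ-unique zero = g-η
      on-Hⁿ-unique (suc n) =
        g ∘ inl ∘ j (suc n)          ≈⟨ refl⟩∘⟨ ≈-sym (a-on-Hⁿ n) ⟩
        g ∘ a ∘ F₁ (inl ∘ j n)       ≈⟨ pullˡ g-morphism ⟩
        (b ∘ F₁ g) ∘ F₁ (inl ∘ j n)  ≈⟨ pullʳ sym-F-∘ ⟩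
        b ∘ F₁ (g ∘ inl ∘ j n)       ≈⟨ refl⟩∘⟨ F-resp-≈ (on-Hⁿ-unique n) ⟩
        b ∘ F₁ (on-Hⁿ n)             ∎
      g-on-νH-fixed : g ∘ inr ≈ b ∘ F₁ (g ∘ inr) ∘ t
      g-on-νH-fixed =
        g ∘ inr                   ≈⟨ ≈-sym (cancelʳ t⁻¹∘t) ⟩
        ((g ∘ inr) ∘ t⁻¹) ∘ t     ≈⟨ pullʳ (≈-sym a-inr) ⟩∘⟨refl ⟩
        (g ∘ a ∘ F₁ inr) ∘ t      ≈⟨ pullˡ g-morphism ⟩∘⟨refl ⟩
        ((b ∘ F₁ g) ∘ F₁ inr) ∘ t ≈⟨ pullʳ sym-F-∘ ⟩∘⟨refl ⟩
        (b ∘ F₁ (g ∘ inr)) ∘ t    ≈⟨ assoc ⟩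
        b ∘ F₁ (g ∘ inr) ∘ t      ∎
      on-component : ∀ n → g ∘ ιC n ≈ extension ∘ ιC n
      on-component zero    = ≈-trans (on-νH-unique (g ∘ inr) g-on-νH-fixed) (≈-sym (extension-β zero))
      on-component (suc n) = ≈-trans (on-Hⁿ-unique n) (≈-sym (extension-β (suc n)))

  is-free-cia : IsFreeCia H a (inl ∘ j zero)
  is-free-cia = is-cia , λ b b-cia f →
    let open Extension b b-cia f in
    extension , (extension-morphism , extension-β 1) , extension-unique

theorem3p5 : ∀ {o ℓ e : Level} (𝒞 : Category o ℓ e) → HyperExtensive 𝒞 →
  (H : Functor 𝒞) → PreservesCountableCoproducts H →
  let open Category 𝒞
      open Functor H
  in
  ∀ {νH : Obj} (t : Hom νH (F₀ νH)) → IsTerminalCoalgebra H t →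
  (t⁻¹ : Hom (F₀ νH) νH) → t⁻¹ ∘ t ≈ id → t ∘ t⁻¹ ≈ id →
  ∀ (Y : Obj) {H*Y : Obj} (j : ∀ n → Hom (iter H n Y) H*Y) →
  IsCoproduct 𝒞 (λ n → iter H n Y) H*Y j →
  (φ : Hom (F₀ H*Y) H*Y) → (∀ n → φ ∘ F₁ (j n) ≈ j (suc n)) →
  ∀ {CY : Obj} (inl : Hom H*Y CY) (inr : Hom νH CY) → IsBinCoproduct 𝒞 inl inr →
  (a : Hom (F₀ CY) CY) → a ∘ F₁ inl ≈ inl ∘ φ → a ∘ F₁ inr ≈ inr ∘ t⁻¹ →
  IsFreeCia H a (inl ∘ j zero)
theorem3p5 𝒞 HE H pres t terminal t⁻¹ t⁻¹∘t t∘t⁻¹ Y j H*Y-coproduct φ φ-j inl inr CY-coproduct a a-inl a-inr =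
  FreeCia.is-free-cia 𝒞 HE H pres t terminal t⁻¹ t⁻¹∘t t∘t⁻¹ Y j H*Y-coproduct φ φ-j
                      inl inr CY-coproduct a a-inl a-inr
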